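{- For any formula $\phi$ of $\mathcal L$: (1) if $\vdash_\Re\phi$, then $\{\xi_u\}_{u\in U}\vDash\phi$ for any enumeration $\{\xi_u\}_{u\in U}$ of nondeterministic partial recursive functions; (2) if $\vdash_{\Re_d}\phi$, then $\{\xi_u\}_{u\in U}\vDash\phi$ for any enumeration $\{\xi_u\}_{u\in U}$ of deterministic partial recursive functions.
   Context: The language $\mathcal L$: formulas built from propositional variables and $\bot$ using $\rightarrow$ and a binary modality $\rhd$; $\wedge,\vee,\neg,\top$ defined as usual. The logic $\Re$: classical propositional logic in $\mathcal L$ plus axioms A1: $\phi\rhd\psi\rightarrow(\chi\rhd\psi\rightarrow(\phi\vee\chi)\rhd\psi)$, A2: $\bot\rhd\phi$, A3: $\phi\rhd\top$, with rules Modus Ponens and M: from $\phi_1\rightarrow\phi_2$ and $\psi_1\rightarrow\psi_2$ infer $\phi_2\rhd\psi_1\rightarrow\phi_1\rhd\psi_2$. The logic $\Re_d$ is $\Re$ plus axiom A4: $\phi\rhd\psi\rightarrow(\phi\rhd\chi\rightarrow\phi\rhd(\psi\wedge\chi))$. Semantics: $U$ is a universe (e.g. all words over an alphabet) and $\{\xi_u\}_{u\in U}$ is an enumeration, indexed by elements of $U$, of partial recursive functions from $U$ to $U$; a nondeterministic partial recursive function $\xi_w$ assigns to each argument $x$ the (possibly empty) set $\xi_w(x)\subseteq U$ of all values a nondeterministic machine computing it may return on input $x$; a deterministic one is the special case where each $\xi_w(x)$ has at most one element. A valuation $*$ maps propositional variables to subsets of $U$ and is extended by $\bot^*=\varnothing$,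 $(\phi\rightarrow\psi)^*=(U\setminus\phi^*)\cup\psi^*$, and $(\phi\rhd\psi)^*=\{w\in U\mid \forall u\in\phi^*\ (\xi_w(u)\neq\varnothing\rightarrow \xi_w(u)\cap\psi^*\neq\varnothing)\}$. We write $\{\xi_u\}_{u\in U}\vDash\phi$ if $\phi^*=U$ for every valuation $*$. -}

module Defs where

open import Data.Nat using (ℕ; zero; suc; _<_)
open import Data.Fin using (Fin)
open import Data.Vec using (Vec; []; _∷_; lookup)
open import Data.Product using (Σ; _×_; _,_)
open import Data.Empty using (⊥)
open import Relation.Binary.PropositionalEquality using (_≡_)

data Rec : ℕ → Set where
  Z  : Rec 0
  S  : Rec 1
  P  : ∀ {n} → Fin n → Rec n
  C  : ∀ {m n} → Rec m → Vec (Rec n) m → Rec n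
  Pr : ∀ {n} → Rec n → Rec (suc (suc n)) → Rec (suc n)
  Mu : ∀ {n} → Rec (suc n) → Rec n

mutual
  data _[_]↦_ : ∀ {n} → Rec n → Vec ℕ n → ℕ → Set where
    evZ  : Z [ [] ]↦ 0
    evS  : ∀ {x} → S [ x ∷ [] ]↦ suc x
    evP  : ∀ {n} {i : Fin n} {xs} → P i [ xs ]↦ lookup xs i
    evC  : ∀ {m n} {f : Rec m} {gs : Vec (Rec n) m} {xs ys y} →
           gs [ xs ]↦* ys → f [ ys ]↦ y → C f gs [ xs ]↦ y
    evPr0 : ∀ {n} {f : Rec n} {g xs y} →
           f [ xs ]↦ y → Pr f g [ 0 ∷ xs ]↦ y
    evPrS : ∀ {n} {f : Rec n} {g k xs z y} →
           Pr f g [ k ∷ xs ]↦ z → g [ k ∷ z ∷ xs ]↦ y →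
           Pr f g [ suc k ∷ xs ]↦ y
    evMu : ∀ {n} {f : Rec (suc n)} {xs y} →
           f [ y ∷ xs ]↦ 0 →
           (∀ z → z < y → Σ ℕ (λ v → f [ z ∷ xs ]↦ suc v)) →
           Mu f [ xs ]↦ y

  data _[_]↦*_ : ∀ {m n} → Vec (Rec n) m → Vec ℕ n → Vec ℕ m → Set where
    []  : ∀ {n} {xs : Vec ℕ n} → [] [ xs ]↦* []
    _∷_ : ∀ {m n} {g : Rec n} {gs : Vec (Rec n) m} {xs y ys} →
          g [ xs ]↦ y → gs [ xs ]↦* ys → (g ∷ gs) [ xs ]↦* (y ∷ ys)

-- The universe U is ℕ (coding words over an alphabet).
-- A (nondeterministic) partial function U → U is given by its value
-- relation F : F x y means y ∈ F(x).

MultiFun : Set₁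
MultiFun = ℕ → ℕ → Set

-- Nondeterministic partial recursive: computed by a nondeterministic
-- machine, i.e. a deterministic partial recursive g run with an arbitrary
-- guess z; F(x) = { y | ∃ z. g(x , z) ↓ = y }.
IsNondetPartialRecursive : MultiFun → Set
IsNondetPartialRecursive F =
  Σ (Rec 2) λ g → ∀ x y →
    (F x y → Σ ℕ (λ z → g [ x ∷ z ∷ [] ]↦ y)) ×
    (Σ ℕ (λ z → g [ x ∷ z ∷ [] ]↦ y) → F x y)

IsDetPartialRecursive : MultiFun → Set
IsDetPartialRecursive F =
  IsNondetPartialRecursive F × (∀ x y y′ → F x y → F x y′ → y ≡ y′)

infixr 5 _⇒_
infix 6 _▷_

data Form : Set where
  var : ℕ → Form
  ⊥′  : Form
  _⇒_ : Form → Form → Form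
  _▷_ : Form → Form → Form

¬′_ : Form → Form
¬′ φ = φ ⇒ ⊥′

⊤′ : Form
⊤′ = ¬′ ⊥′

_∨′_ : Form → Form → Form
φ ∨′ ψ = (¬′ φ) ⇒ ψ

_∧′_ : Form → Form → Form
φ ∧′ ψ = ¬′ (φ ⇒ ¬′ ψ)

data Logic : Set where
  ℜ ℜd : Logic

data _⊢_ (L : Logic) : Form → Set where
  ax-K   : ∀ φ ψ → L ⊢ (φ ⇒ ψ ⇒ φ)
  ax-S   : ∀ φ ψ χ → L ⊢ ((φ ⇒ ψ ⇒ χ) ⇒ (φ ⇒ ψ) ⇒ φ ⇒ χ)
  ax-DNE : ∀ φ → L ⊢ (¬′ ¬′ φ ⇒ φ)
  A1 : ∀ φ ψ χ → L ⊢ (φ ▷ ψ ⇒ χ ▷ ψ ⇒ (φ ∨′ χ) ▷ ψ)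
  A2 : ∀ φ → L ⊢ (⊥′ ▷ φ)
  A3 : ∀ φ → L ⊢ (φ ▷ ⊤′)
  A4 : L ≡ ℜd → ∀ φ ψ χ → L ⊢ (φ ▷ ψ ⇒ φ ▷ χ ⇒ φ ▷ (ψ ∧′ χ))
  MP : ∀ {φ ψ} → L ⊢ (φ ⇒ ψ) → L ⊢ φ → L ⊢ ψ
  M  : ∀ {φ₁ φ₂ ψ₁ ψ₂} → L ⊢ (φ₁ ⇒ φ₂) → L ⊢ (ψ₁ ⇒ ψ₂) →
       L ⊢ (φ₂ ▷ ψ₁ ⇒ φ₁ ▷ ψ₂)

-- Semantics. ξ w is ξ_w; subsets of U are predicates ℕ → Set.

Valuation : Set₁
Valuation = ℕ → ℕ → Set

⟦_⟧ : Form → (ξ : ℕ → MultiFun) → Valuation → ℕ → Set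
⟦ var p ⟧ ξ v w = v p w
⟦ ⊥′ ⟧ ξ v w = ⊥
⟦ φ ⇒ ψ ⟧ ξ v w = ⟦ φ ⟧ ξ v w → ⟦ ψ ⟧ ξ v w
⟦ φ ▷ ψ ⟧ ξ v w =
  ∀ u → ⟦ φ ⟧ ξ v u → Σ ℕ (ξ w u) → Σ ℕ (λ y → ξ w u y × ⟦ ψ ⟧ ξ v y)

_⊨_ : (ℕ → MultiFun) → Form → Set₁
ξ ⊨ φ = ∀ (v : Valuation) w → ⟦ φ ⟧ ξ v w

{-# OPTIONS --safe #-}
module Submission where

open import Defs
open import Axiom.ExcludedMiddle using (ExcludedMiddle)
open import Axiom.DoubleNegationElimination using (em⇒dne)
open import Level using (0ℓ)
open import Data.Product using (Σ; _×_; _,_; proj₂)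
open import Data.Nat using (ℕ)
open import Data.Unit using (⊤)
open import Relation.Nullary using (¬_; yes; no)
open import Relation.Unary using (Pred; _⊆_)
open import Relation.Binary.PropositionalEquality using (_≡_; refl; subst; sym)

-- A1 holds by cases on whether the argument u lies in φ* (classically), and
-- A4 because a single-valued ξ_w(u) has only one value, which must then
-- witness both ψ and χ.

infix 6 _▷⟨_⟩_

-- ⟦ φ ▷ ψ ⟧ ξ v is definitionally ⟦ φ ⟧ ξ v ▷⟨ ξ ⟩ ⟦ ψ ⟧ ξ v.

_▷⟨_⟩_ : Pred ℕ 0ℓ → (ℕ → MultiFun) → Pred ℕ 0ℓ → Pred ℕ 0ℓ
(A ▷⟨ ξ ⟩ B) w = ∀ u → A u → Σ ℕ (ξ w u) → Σ ℕ (λ y → ξ w u y × B y)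

Deterministic : (ℕ → MultiFun) → Set
Deterministic ξ = ∀ w x {y y′} → ξ w x y → ξ w x y′ → y ≡ y′

FrameCondition : Logic → (ℕ → MultiFun) → Set
FrameCondition ℜ  ξ = ⊤
FrameCondition ℜd ξ = Deterministic ξ

isDetPartialRecursive⇒deterministic : ∀ {ξ} →
  (∀ w → IsDetPartialRecursive (ξ w)) → Deterministic ξ
isDetPartialRecursive⇒deterministic detRec w x {y} {y′} = proj₂ (detRec w) x y y′

private
  variable
    A A′ B B′ D : Pred ℕ 0ℓ

module _ (ξ : ℕ → MultiFun) where

  ▷-mono : A′ ⊆ A → B ⊆ B′ → A ▷⟨ ξ ⟩ B ⊆ A′ ▷⟨ ξ ⟩ B′
  ▷-mono A′⊆A B⊆B′ A▷B u a′ defined with A▷B u (A′⊆A a′) defined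
  ... | y , u↦y , b = y , u↦y , B⊆B′ b

  ▷-∨ : ExcludedMiddle 0ℓ →
        ∀ {w} → (A ▷⟨ ξ ⟩ D) w → (B ▷⟨ ξ ⟩ D) w →
        ((λ u → ¬ A u → B u) ▷⟨ ξ ⟩ D) w
  ▷-∨ {A = A} em A▷D B▷D u a∨b defined with em {A u}
  ... | yes a  = A▷D u a defined
  ... | no ¬a  = B▷D u (a∨b ¬a) defined

  ▷-∧ : Deterministic ξ →
        ∀ {w} → (A ▷⟨ ξ ⟩ B) w → (A ▷⟨ ξ ⟩ D) w →
        (A ▷⟨ ξ ⟩ (λ y → ¬ (B y → ¬ D y))) w
  ▷-∧ {D = D} det {w} A▷B A▷D u a defined
    with A▷B u a defined | A▷D u a defined
  ... | y , u↦y , b | y′ , u↦y′ , d =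
    y , u↦y , λ b⇒¬d → b⇒¬d b (subst D (sym (det w u u↦y u↦y′)) d)

module _ (em : ExcludedMiddle 0ℓ) {ξ : ℕ → MultiFun} where

  soundness : ∀ {L φ} → FrameCondition L ξ → L ⊢ φ → ξ ⊨ φ
  soundness cond (ax-K φ ψ)          v w a _           = a
  soundness cond (ax-S φ ψ χ)        v w f g a         = f a (g a)
  soundness cond (ax-DNE φ)          v w               = em⇒dne em
  soundness cond (A1 φ ψ χ)          v w               = ▷-∨ ξ em
  soundness cond (A2 φ)              v w u ()
  soundness cond (A3 φ)              v w u _ (y , u↦y) = y , u↦y , λ ()
  soundness det  (A4 refl φ ψ χ)     v w               = ▷-∧ ξ det
  soundness cond (MP ⊢φ⇒ψ ⊢φ)        v w               =
    soundness cond ⊢φ⇒ψ v w (soundness cond ⊢φ v w)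
  soundness cond (M ⊢φ₁⇒φ₂ ⊢ψ₁⇒ψ₂) v w               =
    ▷-mono ξ (soundness cond ⊢φ₁⇒φ₂ v _) (soundness cond ⊢ψ₁⇒ψ₂ v _)

theorem2 : ExcludedMiddle 0ℓ → ∀ (φ : Form) →
    ((ℜ ⊢ φ) → ∀ (ξ : ℕ → MultiFun) →
      (∀ w → IsNondetPartialRecursive (ξ w)) → ξ ⊨ φ)
    × ((ℜd ⊢ φ) → ∀ (ξ : ℕ → MultiFun) →
      (∀ w → IsDetPartialRecursive (ξ w)) → ξ ⊨ φ)
theorem2 em φ =
  (λ ⊢φ ξ _ → soundness em _ ⊢φ)
  , (λ ⊢φ ξ detRec → soundness em (isDetPartialRecursive⇒deterministic detRec) ⊢φ)
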